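{- Any neutral Z-frame $\mathbf Z$ can be decomposed as an edge-disjoint union $\mathbf Z=\bigcup_i\mathbf T_i$ of closed neutral trails and open neutral trails such that no two of the open trails have a common final match.
   Context: A Z-frame $\mathbf Z$ is a directed bipartite multigraph on disjoint sets of players $V$ and matches $M$ such that every match has degree $1$ or $2$. A directed edge is called positive (charge $+$) if it is directed away from its player and negative if it is directed toward its player. For a player $v$, ${\rm deg}^\pm(v)$ is the number of positive/negative edges at $v$. $\mathbf Z$ is neutral if ${\rm deg}^+(v)={\rm deg}^-(v)$ for all $v\in V$. A trail is a walk in the underlying undirected multigraph using no edge twice; it is closed if it starts and ends at the same vertex and open otherwise. A trail is neutral if at each passage through a player, the two consecutive edges of the trail at that player have opposite charges (so a neutral open trail starts and ends at matches, called its final matches). -}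

module Defs where

open import Data.Nat using (ℕ)
open import Data.Fin using (Fin)
open import Data.Fin.Properties renaming (_≟_ to _≟ᶠ_)
open import Data.List using (List; []; _∷_; length; filter; allFin; concatMap)
open import Data.Sum using (_⊎_; inj₁; inj₂)
open import Data.Product using (_×_; _,_; Σ)
open import Data.Unit using (⊤)
open import Data.Maybe using (Maybe; just; nothing)
open import Relation.Nullary using (¬_; Dec; yes; no)
open import Relation.Nullary.Decidable using (_×-dec_)
open import Relation.Binary.PropositionalEquality using (_≡_; _≢_; refl)
open import Data.List.Relation.Unary.Unique.Propositional using (Unique)

-- Charge of an edge at its player:
--   pos : the edge is directed away from its player
--   neg : the edge is directed toward its player
data Charge : Set where
  pos neg : Charge

_≟ᶜ_ : (a b : Charge) → Dec (a ≡ b)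
pos ≟ᶜ pos = yes refl
pos ≟ᶜ neg = no (λ ())
neg ≟ᶜ pos = no (λ ())
neg ≟ᶜ neg = yes refl

record ZFrame : Set where
  field
    nV nM nE : ℕ
    player   : Fin nE → Fin nV
    match    : Fin nE → Fin nM
    charge   : Fin nE → Charge

  degM : Fin nM → ℕ
  degM m = length (filter (λ e → match e ≟ᶠ m) (allFin nE))

  deg⁺ : Fin nV → ℕ
  deg⁺ v = length (filter (λ e → (player e ≟ᶠ v) ×-dec (charge e ≟ᶜ pos)) (allFin nE))

  deg⁻ : Fin nV → ℕ
  deg⁻ v = length (filter (λ e → (player e ≟ᶠ v) ×-dec (charge e ≟ᶜ neg)) (allFin nE))

  field
    matchDeg : (m : Fin nM) → (degM m ≡ 1) ⊎ (degM m ≡ 2)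

  Vtx : Set
  Vtx = Fin nV ⊎ Fin nM

  Joins : Fin nE → Vtx → Vtx → Set
  Joins e x y = (x ≡ inj₁ (player e) × y ≡ inj₂ (match e))
              ⊎ (x ≡ inj₂ (match e) × y ≡ inj₁ (player e))

open ZFrame public

Neutral-ZFrame : ZFrame → Set
Neutral-ZFrame Z = (v : Fin (nV Z)) → deg⁺ Z v ≡ deg⁻ Z v

module _ (Z : ZFrame) where

  data Walk : Vtx Z → Vtx Z → Set where
    []  : ∀ {x} → Walk x x
    step : ∀ {x y z} (e : Fin (nE Z)) → Joins Z e x y → Walk y z → Walk x z

  edges : ∀ {x y} → Walk x y → List (Fin (nE Z))
  edges [] = []
  edges (step e _ w) = e ∷ edges w

  firstEdge : ∀ {x y} → Walk x y → Maybe (Fin (nE Z))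
  firstEdge [] = nothing
  firstEdge (step e _ _) = just e

  lastEdge : ∀ {x y} → Walk x y → Maybe (Fin (nE Z))
  lastEdge [] = nothing
  lastEdge (step e _ []) = just e
  lastEdge (step e _ w@(step _ _ _)) = lastEdge w

  Passage : Vtx Z → Fin (nE Z) → Fin (nE Z) → Set
  Passage (inj₁ _) e e' = charge Z e ≢ charge Z e'
  Passage (inj₂ _) e e' = ⊤

  NeutralWalk : ∀ {x y} → Walk x y → Set
  NeutralWalk [] = ⊤
  NeutralWalk (step e _ []) = ⊤
  NeutralWalk (step {y = y} e _ w@(step e' _ _)) = Passage y e e' × NeutralWalk w

  WrapNeutral : ∀ {x} → Walk x x → Set
  WrapNeutral {x} w = ∀ e e' → lastEdge w ≡ just e → firstEdge w ≡ just e' → Passage x e e'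

  data NeutralTrail : Set where
    closedT : (x : Vtx Z) (w : Walk x x) → Unique (edges w)
            → NeutralWalk w → WrapNeutral w → NeutralTrail
    openT   : (m m' : Fin (nM Z)) → m ≢ m' → (w : Walk (inj₂ m) (inj₂ m'))
            → Unique (edges w) → NeutralWalk w → NeutralTrail

  trailEdges : NeutralTrail → List (Fin (nE Z))
  trailEdges (closedT _ w _ _ _) = edges w
  trailEdges (openT _ _ _ w _ _) = edges w

  finalMatches : NeutralTrail → List (Fin (nM Z))
  finalMatches (closedT _ _ _ _ _) = []
  finalMatches (openT m m' _ _ _ _) = m ∷ m' ∷ []

{-# OPTIONS --safe #-}
module Submission where

-- Trails are removed one at a time from the list E of unused edges, which stays balanced at
-- every player and has at most two edges at each match.  A trail leaves a player along an unused
-- edge of the opposite charge (it exists by balance) and leaves a match along its other unused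
-- edge, if any; it stops at a match with no unused edge left.  Because matches carry at most two
-- unused edges, the stopping match carries exactly one of the edges still unused after the first
-- step.  So a trail started at a match carrying a single unused edge is open with two distinct
-- final matches, and if no match carries a single unused edge, a trail started anywhere stops at
-- its starting match and is closed.  Final matches have no unused edge once their trail is
-- removed, whereas every later trail ends at matches that still carry unused edges, so no final
-- match is repeated.

open import Defs
open import Data.Product using (Σ; _×_; _,_; proj₁; proj₂)
open import Data.List using (List; []; _∷_; _++_; length; filter; allFin; concatMap)
open import Data.List.Properties using (filter-accept; filter-reject; filter-++; length-++)
open import Data.List.Relation.Unary.All as All using (All; []; _∷_)
open import Data.List.Relation.Unary.All.Properties as All using ()
open import Data.List.Relation.Unary.Unique.Propositional using (Unique; []; _∷_)
open import Data.List.Relation.Unary.Unique.Propositional.Properties as Unique using (allFin⁺)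
open import Data.List.Relation.Binary.Disjoint.Propositional using (Disjoint)
open import Data.List.Relation.Binary.Permutation.Propositional
  using (_↭_; ↭-refl; ↭-prep; ↭-swap; ↭-trans; ↭-sym; ↭⇒↭ₛ)
open import Data.List.Relation.Binary.Permutation.Propositional.Properties
  using (↭-length; filter-↭; ++⁺ˡ)
import Data.List.Relation.Binary.Permutation.Setoid.Properties as Permutationₛ
open import Data.Nat using (ℕ; zero; suc; _+_; _≤_; _<_; z≤n; s≤s; _≟_)
open import Data.Nat.Properties
  using (m≤n+m; +-cancelˡ-≡; suc-injective; n≤0⇒n≡0; <-≤-trans; <-irrefl; ≤-trans; ≤-reflexive;
         ≤⇒≯)
open import Data.Nat.Induction using (<-wellFounded)
open import Induction.WellFounded using (Acc; acc)
open import Data.Fin using (Fin)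
open import Data.Fin.Properties using (any?) renaming (_≟_ to _≟ᶠ_)
open import Data.Sum using (inj₁; inj₂)
open import Data.Unit using (tt)
open import Data.Empty using (⊥-elim)
open import Function using (_∘_)
open import Relation.Nullary using (¬_; Dec; yes; no)
open import Relation.Nullary.Decidable using (_×-dec_; decidable-stable)
open import Relation.Unary using (Pred; Decidable)
open import Relation.Binary.PropositionalEquality
  using (_≡_; _≢_; refl; sym; trans; cong; subst; setoid; module ≡-Reasoning)

module _ {a p} {A : Set a} {P : Pred A p} (P? : Decidable P) where

  count : List A → ℕ
  count xs = length (filter P? xs)

  count-accept : ∀ {x xs} → P x → count (x ∷ xs) ≡ suc (count xs)
  count-accept px = cong length (filter-accept P? px)

  count-reject : ∀ {x xs} → ¬ P x → count (x ∷ xs) ≡ count xs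
  count-reject ¬px = cong length (filter-reject P? ¬px)

  count-↭ : ∀ {xs ys} → xs ↭ ys → count xs ≡ count ys
  count-↭ xs↭ys = ↭-length (filter-↭ P? xs↭ys)

  count-++ : ∀ xs ys → count (xs ++ ys) ≡ count xs + count ys
  count-++ xs ys = trans (cong length (filter-++ P? xs ys)) (length-++ (filter P? xs))

  count-↭-suffix : ∀ {xs} ys zs → xs ↭ ys ++ zs → count zs ≤ count xs
  count-↭-suffix ys zs xs↭ = subst (count zs ≤_)
    (sym (trans (count-↭ xs↭) (count-++ ys zs))) (m≤n+m (count zs) (count ys))

  extract : ∀ xs {n} → count xs ≡ suc n → Σ A λ x → P x × Σ (List A) λ ys → xs ↭ x ∷ ys
  extract (x ∷ xs) eq with P? x
  ... | yes px = x , px , xs , ↭-refl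
  ... | no ¬px with extract xs eq
  ...   | y , py , ys , xs↭ = y , py , x ∷ ys , ↭-trans (↭-prep x xs↭) (↭-swap x y ↭-refl)

module _ {a} {A : Set a} where

  Unique-resp-↭ : ∀ {xs ys : List A} → xs ↭ ys → Unique xs → Unique ys
  Unique-resp-↭ xs↭ys = Permutationₛ.Unique-resp-↭ (setoid A) (↭⇒↭ₛ xs↭ys)

  Unique-++⁻ : ∀ (xs : List A) {ys} → Unique (xs ++ ys) → Unique xs × Unique ys
  Unique-++⁻ []       u        = [] , u
  Unique-++⁻ (x ∷ xs) (x∉ ∷ u) with Unique-++⁻ xs u
  ... | uxs , uys = (All.++⁻ˡ xs x∉ ∷ uxs) , uys

  ↭-length-< : ∀ {xs : List A} y ys zs → xs ↭ y ∷ ys ++ zs → length zs < length xs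
  ↭-length-< y ys zs xs↭ = subst (length zs <_)
    (sym (trans (↭-length xs↭) (cong suc (length-++ ys))))
    (s≤s (m≤n+m (length zs) (length ys)))

opp : Charge → Charge
opp pos = neg
opp neg = pos

opp-≢ : ∀ c → c ≢ opp c
opp-≢ pos ()
opp-≢ neg ()

≢⇒≡opp : ∀ {c d} → c ≢ d → d ≡ opp c
≢⇒≡opp {pos} {pos} c≢d = ⊥-elim (c≢d refl)
≢⇒≡opp {pos} {neg} _   = refl
≢⇒≡opp {neg} {pos} _   = refl
≢⇒≡opp {neg} {neg} c≢d = ⊥-elim (c≢d refl)

module _ (Z : ZFrame) where

  Edge : Set
  Edge = Fin (nE Z)

  Match : Set
  Match = Fin (nM Z)

  at? : (v : Fin (nV Z)) (c : Charge) → Decidable (λ e → player Z e ≡ v × charge Z e ≡ c)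
  at? v c e = (player Z e ≟ᶠ v) ×-dec (charge Z e ≟ᶜ c)

  on? : (m : Match) → Decidable (λ e → match Z e ≡ m)
  on? m e = match Z e ≟ᶠ m

  -- On allFin (nE Z) this is Neutral-ZFrame Z by definition.
  Balanced : List Edge → Set
  Balanced L = ∀ v → count (at? v pos) L ≡ count (at? v neg) L

  MatchDeg≤2 : List Edge → Set
  MatchDeg≤2 L = ∀ m → count (on? m) L ≤ 2

  Balanced-↭ : ∀ {L L'} → L ↭ L' → Balanced L → Balanced L'
  Balanced-↭ L↭L' bal v =
    trans (sym (count-↭ (at? v pos) L↭L')) (trans (bal v) (count-↭ (at? v neg) L↭L'))

  Balanced-opp : ∀ {L} → Balanced L → ∀ v c → count (at? v c) L ≡ count (at? v (opp c)) L
  Balanced-opp bal v pos = bal v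
  Balanced-opp bal v neg = sym (bal v)

  MatchDeg≤2-suffix : ∀ {L} xs L' → L ↭ xs ++ L' → MatchDeg≤2 L → MatchDeg≤2 L'
  MatchDeg≤2-suffix xs L' L↭ deg m = ≤-trans (count-↭-suffix (on? m) xs L' L↭) (deg m)

  Opposite : Edge → Edge → Set
  Opposite e f = player Z f ≡ player Z e × charge Z f ≡ opp (charge Z e)

  Opposite⇒Passage : ∀ {e f} → Opposite e f → Passage Z (inj₁ (player Z e)) e f
  Opposite⇒Passage {e} (_ , cf) ce≡cf = opp-≢ (charge Z e) (trans ce≡cf cf)

  pair-count : ∀ {e f v} c → Opposite e f → player Z e ≡ v → count (at? v c) (e ∷ f ∷ []) ≡ 1
  pair-count {e} {f} {v} c (pf , cf) pe = by-charge (charge Z e ≟ᶜ c)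
    where
    by-charge : Dec (charge Z e ≡ c) → count (at? v c) (e ∷ f ∷ []) ≡ 1
    by-charge (yes ce) = trans (count-accept (at? v c) (pe , ce))
      (cong suc (count-reject (at? v c)
        λ (_ , cf') → opp-≢ c (trans (sym cf') (trans cf (cong opp ce)))))
    by-charge (no ce) = trans (count-reject (at? v c) (ce ∘ proj₂))
      (count-accept (at? v c) (trans pf pe , trans cf (sym (≢⇒≡opp ce))))

  pair-absent : ∀ {e f v} c → Opposite e f → player Z e ≢ v → count (at? v c) (e ∷ f ∷ []) ≡ 0
  pair-absent {v = v} c (pf , _) pe = trans (count-reject (at? v c) (pe ∘ proj₁))
    (count-reject (at? v c) (pe ∘ trans (sym pf) ∘ proj₁))

  pair-balanced : ∀ {e f} → Opposite e f → Balanced (e ∷ f ∷ [])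
  pair-balanced {e} {f} ef v = by-player (player Z e ≟ᶠ v)
    where
    by-player : Dec (player Z e ≡ v) → count (at? v pos) (e ∷ f ∷ []) ≡ count (at? v neg) (e ∷ f ∷ [])
    by-player (yes pe) = trans (pair-count pos ef pe) (sym (pair-count neg ef pe))
    by-player (no pe)  = trans (pair-absent pos ef pe) (sym (pair-absent neg ef pe))

  Balanced-remove-pair : ∀ {e f L} → Opposite e f → Balanced (e ∷ f ∷ L) → Balanced L
  Balanced-remove-pair {e} {f} {L} e-f bal v = +-cancelˡ-≡ (count (at? v pos) ef) _ _ (begin
      count (at? v pos) ef + count (at? v pos) L  ≡⟨ count-++ (at? v pos) ef L ⟨
      count (at? v pos) (ef ++ L)                 ≡⟨ bal v ⟩
      count (at? v neg) (ef ++ L)                 ≡⟨ count-++ (at? v neg) ef L ⟩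
      count (at? v neg) ef + count (at? v neg) L  ≡⟨ cong (_+ _) (pair-balanced e-f v) ⟨
      count (at? v pos) ef + count (at? v neg) L  ∎)
    where
    open ≡-Reasoning
    ef : List Edge
    ef = e ∷ f ∷ []

  partner : ∀ {e E} → Balanced (e ∷ E) →
    Σ Edge λ f → Opposite e f × Σ (List Edge) λ E₁ → E ↭ f ∷ E₁ × Balanced E₁
  partner {e} {E} bal =
    let f , e-f , E₁ , E↭ = extract (at? v (opp c)) E opposite-unused
    in  f , e-f , E₁ , E↭ , Balanced-remove-pair e-f (Balanced-↭ (↭-prep e E↭) bal)
    where
    open ≡-Reasoning
    v : Fin (nV Z)
    v = player Z e
    c : Charge
    c = charge Z e
    opposite-unused : count (at? v (opp c)) E ≡ suc (count (at? v c) E)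
    opposite-unused = begin
      count (at? v (opp c)) E        ≡⟨ count-reject (at? v (opp c)) (opp-≢ c ∘ proj₂) ⟨
      count (at? v (opp c)) (e ∷ E)  ≡⟨ Balanced-opp {e ∷ E} bal v c ⟨
      count (at? v c) (e ∷ E)        ≡⟨ count-accept (at? v c) (refl , refl) ⟩
      suc (count (at? v c) E)        ∎

  toMatch : ∀ {e v} → player Z e ≡ v → Joins Z e (inj₁ v) (inj₂ (match Z e))
  toMatch pe = inj₁ (cong inj₁ (sym pe) , refl)

  toPlayer : ∀ {e m} → match Z e ≡ m → Joins Z e (inj₂ m) (inj₁ (player Z e))
  toPlayer me = inj₂ (cong inj₂ (sym me) , refl)

  -- The rest of a trail that has just reached the player of e along e, using only edges of E.
  -- end-single is what identifies the end: it cannot be the start of an open trail, and must be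
  -- the start of a closed one.
  record Extension (e : Edge) (E : List Edge) : Set where
    field
      end         : Match
      walk        : Walk Z (inj₁ (player Z e)) (inj₂ end)
      rest        : List Edge
      split       : E ↭ edges Z walk ++ rest
      neutral     : ∀ {x} (J : Joins Z e x (inj₁ (player Z e))) → NeutralWalk Z (step e J walk)
      balanced    : Balanced rest
      end-single  : count (on? end) E ≡ 1
      end-cleared : count (on? end) rest ≡ 0

  stop : ∀ {e f E E₁} → Opposite e f → E ↭ f ∷ E₁ → Balanced E₁ → count (on? (match Z f)) E₁ ≡ 0 →
    Extension e E
  stop {f = f} {E₁ = E₁} e-f E↭ bal₁ cleared = record
    { end         = match Z f
    ; walk        = step f (toMatch (proj₁ e-f)) []
    ; rest        = E₁
    ; split       = E↭
    ; neutral     = λ _ → Opposite⇒Passage e-f , tt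
    ; balanced    = bal₁
    ; end-single  = trans (count-↭ (on? (match Z f)) E↭)
                      (trans (count-accept (on? (match Z f)) refl) (cong suc cleared))
    ; end-cleared = cleared
    }

  continue : ∀ {e f g E E₂} → Opposite e f → match Z g ≡ match Z f → E ↭ f ∷ g ∷ E₂ →
    MatchDeg≤2 E → Extension g E₂ → Extension e E
  continue {f = f} {g} {E} {E₂} e-f mg E↭ deg ext = record
    { end         = end
    ; walk        = step f (toMatch (proj₁ e-f)) (step g (toPlayer mg) walk)
    ; rest        = rest
    ; split       = ↭-trans E↭ (↭-prep f (↭-prep g split))
    ; neutral     = λ _ → Opposite⇒Passage e-f , tt , neutral (toPlayer mg)
    ; balanced    = balanced
    ; end-single  = trans (count-↭ (on? end) E↭)
                      (trans (count-reject (on? end) f≢end)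
                        (trans (count-reject (on? end) (f≢end ∘ trans (sym mg))) end-single))
    ; end-cleared = end-cleared
    }
    where
    open Extension ext
    f≢end : match Z f ≢ end
    f≢end mf = ≤⇒≯ (deg end) (≤-reflexive (sym (begin
      count (on? end) E               ≡⟨ count-↭ (on? end) E↭ ⟩
      count (on? end) (f ∷ g ∷ E₂)    ≡⟨ count-accept (on? end) mf ⟩
      suc (count (on? end) (g ∷ E₂))  ≡⟨ cong suc (count-accept (on? end) (trans mg mf)) ⟩
      suc (suc (count (on? end) E₂))  ≡⟨ cong (suc ∘ suc) end-single ⟩
      3                               ∎)))
      where open ≡-Reasoning

  extend : ∀ e E → Acc _<_ (length E) → Balanced (e ∷ E) → MatchDeg≤2 E → Extension e E
  extend e E (acc smaller) bal deg with partner bal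
  ... | f , e-f , E₁ , E↭fE₁ , bal₁ with count (on? (match Z f)) E₁ in eq
  ... | zero  = stop e-f E↭fE₁ bal₁ eq
  ... | suc _ with extract (on? (match Z f)) E₁ eq
  ...   | g , mg , E₂ , E₁↭gE₂ = continue e-f mg E↭ deg
            (extend g E₂ (smaller (↭-length-< f (g ∷ []) E₂ E↭)) (Balanced-↭ E₁↭gE₂ bal₁)
              (MatchDeg≤2-suffix (f ∷ g ∷ []) E₂ E↭ deg))
    where
    E↭ : E ↭ f ∷ g ∷ E₂
    E↭ = ↭-trans E↭fE₁ (↭-prep f E₁↭gE₂)

  record FirstTrail (E : List Edge) : Set where
    field
      trail          : NeutralTrail Z
      rest           : List Edge
      split          : E ↭ trailEdges Z trail ++ rest
      shorter        : length rest < length E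
      balanced       : Balanced rest
      finals-unique  : Unique (finalMatches Z trail)
      finals-used-up : All (λ m → count (on? m) rest ≡ 0 × 0 < count (on? m) E) (finalMatches Z trail)

  openTrail : ∀ {m E} → count (on? m) E ≡ 1 → Unique E → Balanced E → MatchDeg≤2 E → FirstTrail E
  openTrail {m} {E} m-single u bal deg with extract (on? m) E m-single
  ... | e , me , E₂ , E↭eE₂ = record
    { trail         = openT m end m≢end (step e (toPlayer me) walk) unique (neutral (toPlayer me))
    ; rest          = rest
    ; split         = E↭
    ; shorter       = ↭-length-< e (edges Z walk) rest E↭
    ; balanced      = balanced
    ; finals-unique = (m≢end ∷ []) ∷ [] ∷ []
    ; finals-used-up = (m-cleared , m-present) ∷ (end-cleared , end-present) ∷ []
    }
    where
    open Extension (extend e E₂ (<-wellFounded _) (Balanced-↭ E↭eE₂ bal)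
                      (MatchDeg≤2-suffix (e ∷ []) E₂ E↭eE₂ deg))
    E↭ : E ↭ (e ∷ edges Z walk) ++ rest
    E↭ = ↭-trans E↭eE₂ (↭-prep e split)
    unique : Unique (e ∷ edges Z walk)
    unique = proj₁ (Unique-++⁻ (e ∷ edges Z walk) (Unique-resp-↭ E↭ u))
    m-absent : count (on? m) E₂ ≡ 0
    m-absent = suc-injective (trans (sym (count-accept (on? m) me))
                               (trans (sym (count-↭ (on? m) E↭eE₂)) m-single))
    m≢end : m ≢ end
    m≢end m≡end with () ← trans (sym m-absent)
                             (trans (cong (λ x → count (on? x) E₂) m≡end) end-single)
    m-cleared : count (on? m) rest ≡ 0
    m-cleared = n≤0⇒n≡0 (subst (count (on? m) rest ≤_) m-absent
                           (count-↭-suffix (on? m) (edges Z walk) rest split))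
    m-present : 0 < count (on? m) E
    m-present = ≤-reflexive (sym m-single)
    end-present : 0 < count (on? end) E
    end-present = ≤-trans (≤-reflexive (sym end-single))
                    (count-↭-suffix (on? end) (e ∷ []) E₂ E↭eE₂)

  closedTrail : ∀ {e E} → (∀ m → count (on? m) (e ∷ E) ≢ 1) →
    Unique (e ∷ E) → Balanced (e ∷ E) → MatchDeg≤2 (e ∷ E) → FirstTrail (e ∷ E)
  closedTrail {e} {E} no-single u bal deg = record
    { trail         = closedT (inj₂ end) (step e (toPlayer e-at-end) walk) unique
                        (neutral (toPlayer e-at-end)) (λ _ _ _ _ → tt)
    ; rest          = rest
    ; split         = E↭
    ; shorter       = ↭-length-< e (edges Z walk) rest E↭
    ; balanced      = balanced
    ; finals-unique = []
    ; finals-used-up = []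
    }
    where
    open Extension (extend e E (<-wellFounded _) bal (MatchDeg≤2-suffix (e ∷ []) E ↭-refl deg))
    E↭ : e ∷ E ↭ (e ∷ edges Z walk) ++ rest
    E↭ = ↭-prep e split
    unique : Unique (e ∷ edges Z walk)
    unique = proj₁ (Unique-++⁻ (e ∷ edges Z walk) (Unique-resp-↭ E↭ u))
    e-at-end : match Z e ≡ end
    e-at-end = decidable-stable (match Z e ≟ᶠ end)
      (λ e≢end → no-single end (trans (count-reject (on? end) e≢end) end-single))

  firstTrail : ∀ {e E} → Unique (e ∷ E) → Balanced (e ∷ E) → MatchDeg≤2 (e ∷ E) → FirstTrail (e ∷ E)
  firstTrail {e} {E} u bal deg with any? (λ m → count (on? m) (e ∷ E) ≟ 1)
  ... | yes (m , m-single) = openTrail m-single u bal deg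
  ... | no  no-single      = closedTrail (λ m m-single → no-single (m , m-single)) u bal deg

  record Decomposition (E : List Edge) : Set where
    field
      trails        : List (NeutralTrail Z)
      covers        : concatMap (trailEdges Z) trails ↭ E
      finals-unique : Unique (concatMap (finalMatches Z) trails)
      finals-occur  : All (λ m → 0 < count (on? m) E) (concatMap (finalMatches Z) trails)

  _◅_ : ∀ {E} (T : FirstTrail E) → Decomposition (FirstTrail.rest T) → Decomposition E
  _◅_ {E} T D = record
    { trails        = trail ∷ D.trails
    ; covers        = ↭-trans (++⁺ˡ (trailEdges Z trail) D.covers) (↭-sym split)
    ; finals-unique = Unique.++⁺ finals-unique D.finals-unique disjoint
    ; finals-occur  = All.++⁺ (All.map proj₂ finals-used-up) (All.map occur-in-E D.finals-occur)
    }
    where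
    open FirstTrail T
    module D = Decomposition D
    occur-in-E : ∀ {m} → 0 < count (on? m) rest → 0 < count (on? m) E
    occur-in-E {m} present = <-≤-trans present (count-↭-suffix (on? m) (trailEdges Z trail) rest split)
    disjoint : Disjoint (finalMatches Z trail) (concatMap (finalMatches Z) D.trails)
    disjoint (m∈T , m∈D) = <-irrefl refl
      (subst (0 <_) (proj₁ (All.lookup finals-used-up m∈T)) (All.lookup D.finals-occur m∈D))

  decompose : ∀ {E} → Acc _<_ (length E) → Unique E → Balanced E → MatchDeg≤2 E → Decomposition E
  decompose {[]} _ _ _ _ =
    record { trails = [] ; covers = ↭-refl ; finals-unique = [] ; finals-occur = [] }
  decompose {e ∷ E} (acc smaller) u bal deg = T ◅ decompose (smaller shorter)
      (proj₂ (Unique-++⁻ (trailEdges Z trail) (Unique-resp-↭ split u))) balanced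
      (MatchDeg≤2-suffix (trailEdges Z trail) rest split deg)
    where
    T : FirstTrail (e ∷ E)
    T = firstTrail u bal deg
    open FirstTrail T

  MatchDeg≤2-allFin : MatchDeg≤2 (allFin (nE Z))
  MatchDeg≤2-allFin m with matchDeg Z m
  ... | inj₁ deg≡1 = ≤-trans (≤-reflexive deg≡1) (s≤s z≤n)
  ... | inj₂ deg≡2 = ≤-reflexive deg≡2

lemma9 : (Z : ZFrame) → Neutral-ZFrame Z →
    Σ (List (NeutralTrail Z)) λ Ts →
      (concatMap (trailEdges Z) Ts ↭ allFin (nE Z))
      × Unique (concatMap (finalMatches Z) Ts)
lemma9 Z neutral = trails , covers , finals-unique
  where
  open Decomposition
    (decompose Z (<-wellFounded _) (allFin⁺ (nE Z)) neutral (MatchDeg≤2-allFin Z))
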